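{- Let $m,n\geq 2$ and $k,r$ be positive integers with $k\mid r$. Then $\Gamma^k_{m,n}(r)\cong\Gamma^k_{m,n}(k)\left[\overline{K_{r/k}}\right]$, where $\overline{K_{r/k}}$ is the edgeless graph on $r/k$ vertices.
   Context: $[t]=\{1,\dots,t\}$. For $k\mid r$, fix a partition $\pi=\{P_1,\dots,P_k\}$ of $[r]$ into $k$ parts of equal size. The graph $\Gamma^k_{m,n}(r)$ has vertex set $\{(a,b,c):a\in[r],b\in[m],c\in[n]\}$, and $(a,b,c)\sim(a',b',c')$ iff either ($c=c'$ and $b\neq b'$) or ($c\neq c'$ and $a,a'$ lie in different parts of $\pi$). (For $r=k$ the parts are singletons.) The lexicographic product $X[Y]$ has vertex set $V(X)\times V(Y)$, with $(x,y)\sim(x',y')$ iff $x\sim_X x'$, or $x=x'$ and $y\sim_Y y'$. -}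

module Defs where

open import Level using (0ℓ)
open import Data.Nat using (ℕ; _/_; NonZero)
open import Data.Fin using (Fin; _≟_)
open import Data.List using (length; filter)
open import Data.List.Base using (allFin)
open import Data.Product using (_×_; _,_; Σ)
open import Data.Sum using (_⊎_)
open import Data.Empty using (⊥)
open import Relation.Nullary using (¬_)
open import Relation.Binary.PropositionalEquality using (_≡_)
open import Function.Bundles using (_↔_; Inverse; _⇔_)

record Graph : Set₁ where
  field
    V   : Set
    Adj : V → V → Set
open Graph public

_≅_ : Graph → Graph → Set
G ≅ H = Σ (V G ↔ V H) λ f →
  ∀ x y → Adj G x y ⇔ Adj H (Inverse.to f x) (Inverse.to f y)

-- A partition of [r] into k parts, encoded by its part-assignment map p : [r] → [k];
-- "equal size" means every part has exactly r/k elements (so all k parts are nonempty).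
IsEqualPartition : (k r : ℕ) .{{_ : NonZero k}} → (Fin r → Fin k) → Set
IsEqualPartition k r p =
  ∀ (j : Fin k) → length (filter (λ a → p a ≟ j) (allFin r)) ≡ r / k

Gamma : (k m n r : ℕ) → (Fin r → Fin k) → Graph
Gamma k m n r p = record
  { V   = Fin r × Fin m × Fin n
  ; Adj = λ { (a , b , c) (a' , b' , c') →
              (c ≡ c' × ¬ (b ≡ b')) ⊎ (¬ (c ≡ c') × ¬ (p a ≡ p a')) }
  }

Lex : Graph → Graph → Graph
Lex X Y = record
  { V   = V X × V Y
  ; Adj = λ { (x , y) (x' , y') → Adj X x x' ⊎ (x ≡ x' × Adj Y y y') }
  }

Edgeless : ℕ → Graph
Edgeless t = record { V = Fin t ; Adj = λ _ _ → ⊥ }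

-- Adjacency in Γ^k_{m,n}(r) depends on a ∈ [r] only through its part p a, so the
-- map (a , b , c) ↦ (p a , b , c) onto Γ^k_{m,n}(k) preserves and reflects adjacency.
-- A graph G with such a map onto H, all of whose fibres have t elements, is H with
-- each vertex blown up into an independent set of size t, i.e. H[K̄_t]. Here the
-- fibre over (j , b , c) is a copy of the part P_j, of size r/k.
module Submission where

open import Defs
open import Data.Nat using (ℕ; zero; suc; _≤_; _/_; NonZero)
open import Data.Nat.Divisibility using (_∣_)
open import Data.Fin using (Fin; _≟_)
open import Function using (id; _∘_)

open import Data.List using (length; filter; tabulate; allFin)
open import Data.Product using (Σ; _×_; _,_; proj₁; map₁)
open import Data.Sum using (_⊎_; inj₁; inj₂)
open import Data.Sum.Function.Propositional using (_⊎-cong_)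
open import Data.Empty using (⊥-elim)
open import Relation.Nullary using (¬_; yes; no)
open import Relation.Nullary.Irrelevant using (Irrelevant)
open import Relation.Unary using (Pred; Decidable)
open import Relation.Binary.PropositionalEquality using (_≡_; refl; cong; subst)
open import Function.Bundles using (_↔_; _⇔_; Inverse; mk↔ₛ′; mk⇔)
open import Function.Construct.Composition using (_⇔-∘_)
open import Function.Construct.Identity using (⇔-id)
open import Function.Properties.Inverse using (↔-refl; ↔-trans)
open import Axiom.UniquenessOfIdentityProofs using (module Decidable⇒UIP)
import Data.Fin as Fin

private
  variable
    A B C : Set
    k n l t : ℕ

fibre : (A → B) → B → Set
fibre {A} f b = Σ A λ a → f a ≡ b

Σ-fibre-↔ : (f : A → B) → A ↔ Σ B (fibre f)
Σ-fibre-↔ f = mk↔ₛ′ (λ a → f a , a , refl) (λ (_ , a , _) → a)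
  (λ { (_ , _ , refl) → refl }) (λ _ → refl)

Σ-const-↔ : {F : B → Set} → (∀ b → F b ↔ C) → Σ B F ↔ (B × C)
Σ-const-↔ F↔C = mk↔ₛ′
  (λ (b , x) → b , Inverse.to (F↔C b) x)
  (λ (b , c) → b , Inverse.from (F↔C b) c)
  (λ (b , c) → cong (b ,_) (Inverse.strictlyInverseˡ (F↔C b) c))
  (λ (b , x) → cong (b ,_) (Inverse.strictlyInverseʳ (F↔C b) x))

fibre-map₁-↔ : (f : A → B) (b : B) (c : C) → fibre (map₁ f) (b , c) ↔ fibre f b
fibre-map₁-↔ f b c = mk↔ₛ′ (λ { ((a , _) , refl) → a , refl }) (λ { (a , refl) → (a , c) , refl })
  (λ { (_ , refl) → refl }) (λ { (_ , refl) → refl })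

Σ-Fin-suc-↔ : (Q : Fin (suc n) → Set) → Σ (Fin (suc n)) Q ↔ (Q Fin.zero ⊎ Σ (Fin n) (Q ∘ Fin.suc))
Σ-Fin-suc-↔ Q = mk↔ₛ′
  (λ { (Fin.zero , q) → inj₁ q ; (Fin.suc i , q) → inj₂ (i , q) })
  (λ { (inj₁ q) → Fin.zero , q ; (inj₂ (i , q)) → Fin.suc i , q })
  (λ { (inj₁ _) → refl ; (inj₂ _) → refl })
  (λ { (Fin.zero , _) → refl ; (Fin.suc _ , _) → refl })

uninhabited-⊎-↔ : ¬ A → (A ⊎ B) ↔ B
uninhabited-⊎-↔ ¬a = mk↔ₛ′ (λ { (inj₁ a) → ⊥-elim (¬a a) ; (inj₂ b) → b }) inj₂
  (λ _ → refl) (λ { (inj₁ a) → ⊥-elim (¬a a) ; (inj₂ _) → refl })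

singleton-⊎-↔ : Irrelevant A → A → (A ⊎ Fin l) ↔ Fin (suc l)
singleton-⊎-↔ irr a = mk↔ₛ′
  (λ { (inj₁ _) → Fin.zero ; (inj₂ i) → Fin.suc i })
  (λ { Fin.zero → inj₁ a ; (Fin.suc i) → inj₂ i })
  (λ { Fin.zero → refl ; (Fin.suc _) → refl })
  (λ { (inj₁ a′) → cong inj₁ (irr a a′) ; (inj₂ _) → refl })

Σ-filter-tabulate-↔ : {P : Pred A _} (P? : Decidable P) → (∀ {x} → Irrelevant (P x)) →
  (g : Fin n → A) → Σ (Fin n) (P ∘ g) ↔ Fin (length (filter P? (tabulate g)))
Σ-filter-tabulate-↔ {n = zero} P? irr g = mk↔ₛ′ (λ ()) (λ ()) (λ ()) (λ ())
Σ-filter-tabulate-↔ {n = suc n} P? irr g with P? (g Fin.zero)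
... | yes pz = ↔-trans (Σ-Fin-suc-↔ _)
  (↔-trans (↔-refl ⊎-cong Σ-filter-tabulate-↔ P? irr (g ∘ Fin.suc)) (singleton-⊎-↔ irr pz))
... | no ¬pz = ↔-trans (Σ-Fin-suc-↔ _)
  (↔-trans (↔-refl ⊎-cong Σ-filter-tabulate-↔ P? irr (g ∘ Fin.suc)) (uninhabited-⊎-↔ ¬pz))

fibre-count-↔ : (p : Fin n → Fin k) (j : Fin k) →
  fibre p j ↔ Fin (length (filter (λ a → p a ≟ j) (allFin n)))
fibre-count-↔ p j = Σ-filter-tabulate-↔ (λ a → p a ≟ j) (Decidable⇒UIP.≡-irrelevant _≟_) id

Lex-Edgeless-adj : (H : Graph) (u v : V H × Fin t) →
  Adj H (proj₁ u) (proj₁ v) ⇔ Adj (Lex H (Edgeless t)) u v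
Lex-Edgeless-adj H u v = mk⇔ inj₁ λ { (inj₁ uv) → uv ; (inj₂ (_ , ())) }

≅-Lex-Edgeless : (G H : Graph) (f : V G → V H) →
  (∀ x y → Adj G x y ⇔ Adj H (f x) (f y)) → (∀ h → fibre f h ↔ Fin t) →
  G ≅ Lex H (Edgeless t)
-- The first component of Inverse.to blowup x computes to f x, so f-adj applies as is.
≅-Lex-Edgeless {t} G H f f-adj fibres = blowup ,
  λ x y → Lex-Edgeless-adj H (Inverse.to blowup x) (Inverse.to blowup y) ⇔-∘ f-adj x y
  where
  blowup : V G ↔ (V H × Fin t)
  blowup = ↔-trans (Σ-fibre-↔ f) (Σ-const-↔ fibres)

corollary3p3 : (m n k r : ℕ) → 2 ≤ m → 2 ≤ n → .{{_ : NonZero k}} → 1 ≤ r → k ∣ r →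
    (p : Fin r → Fin k) → IsEqualPartition k r p →
    Gamma k m n r p ≅ Lex (Gamma k m n k id) (Edgeless (r / k))
corollary3p3 m n k r _ _ _ _ p parts-equal =
  ≅-Lex-Edgeless (Gamma k m n r p) (Gamma k m n k id) (map₁ p) (λ _ _ → ⇔-id _) fibres
  where
  fibres : ∀ v → fibre (map₁ p) v ↔ Fin (r / k)
  fibres (j , bc) = subst (λ l → fibre (map₁ p) (j , bc) ↔ Fin l) (parts-equal j)
    (↔-trans (fibre-map₁-↔ p j bc) (fibre-count-↔ p j))
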